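{- For every positive integer $n$, $\overline{p}_{3,3}(n)$ equals the number of Garden of Eden partitions of $n$, i.e. the number of partitions of $n$ with rank $\leq -2$.
   Context: A partition of $n$ is a finite multiset of positive integers summing to $n$. The rank of a partition is its largest part minus its number of parts; Garden of Eden partitions of $n$ are the partitions of $n$ of rank $-2$ or less. For positive integers $A,a$ and a partition $\pi$, $\mathrm{mex}_{A,a}(\pi)$ is the smallest element of $\{a,a+A,a+2A,\dots\}$ that is not a part of $\pi$. $\overline{p}_{A,a}(n)$ is the number of partitions $\pi$ of $n$ with $\mathrm{mex}_{A,a}(\pi)\equiv A+a \pmod{2A}$. -}

module Defs where

open import Data.Nat using (ℕ; NonZero; _*_; zero; suc; _+_; _%_; _≡ᵇ_; _≤ᵇ_; _<ᵇ_; _⊔_)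
open import Data.Integer as ℤ using (ℤ; +_; -[1+_]; _-_)
open import Data.Bool using (Bool; true; false; _∧_; if_then_else_; T)
open import Data.List using (List; []; _∷_; length; foldr)
open import Data.Nat.Properties using (m*n≢0)
open import Data.Nat.ListAction using (sum)
open import Data.Bool.ListAction using (any)
open import Data.Product using (Σ)
open import Function.Bundles using (_↔_)
open import Relation.Nullary.Decidable using (⌊_⌋)

-- A partition (finite multiset of positive integers) is represented canonically
-- as the list of its parts in nonincreasing order.

allPositive : List ℕ → Bool
allPositive []       = true
allPositive (x ∷ xs) = (0 <ᵇ x) ∧ allPositive xs

nonincreasing : List ℕ → Bool
nonincreasing []           = true
nonincreasing (x ∷ [])     = true
nonincreasing (x ∷ y ∷ xs) = (y ≤ᵇ x) ∧ nonincreasing (y ∷ xs)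

isPartition : ℕ → List ℕ → Bool
isPartition n π = allPositive π ∧ nonincreasing π ∧ (sum π ≡ᵇ n)

PartitionsWith : ℕ → (List ℕ → Bool) → Set
PartitionsWith n P = Σ (List ℕ) (λ π → T (isPartition n π ∧ P π))

_∈ᵇ_ : ℕ → List ℕ → Bool
m ∈ᵇ π = any (λ x → m ≡ᵇ x) π

mexGo : ℕ → ℕ → ℕ → List ℕ → ℕ
mexGo zero    A c π = c
mexGo (suc f) A c π = if c ∈ᵇ π then mexGo f A (c + A) π else c

-- mex_{A,a}(π): smallest element of {a, a+A, a+2A, ...} not a part of π.
-- For A ≥ 1 the fuel  length π  suffices: among the length π + 1 distinct
-- candidates a, ..., a + (length π)·A at least one is not a part of π.
mex : ℕ → ℕ → List ℕ → ℕ
mex A a π = mexGo (length π) A a π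

mexCond : (A : ℕ) → .{{NonZero A}} → ℕ → List ℕ → Bool
mexCond A a π = let instance _ = m*n≢0 2 A in (mex A a π % (2 * A)) ≡ᵇ ((A + a) % (2 * A))

largestPart : List ℕ → ℕ
largestPart = foldr _⊔_ 0

rank : List ℕ → ℤ
rank π = + largestPart π - + length π

gardenOfEden : List ℕ → Bool
gardenOfEden π = ⌊ rank π ℤ.≤? -[1+ 1 ] ⌋

{-# OPTIONS --safe #-}
-- Write f_a(n) for the number of partitions of n whose mex_{3,a} is ≡ a + 3 (mod 6), and g_a(n)
-- for the number with rank ≤ 1 − a. For a ≥ 2 both vanish when n < a, and both satisfy
--   f_a(a + N) + f_{a+3}(N) = p(N).
-- For f, adding a part a to a partition ρ of N turns mex_{3,a+3}(ρ) into mex_{3,a} of the new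
-- partition; that value lies in a + 3 + 3ℕ, so its residue mod 6 is a or a + 3 and the condition
-- flips (this works for any modulus A in place of 3). For g, Dyson's map (delete the first column,
-- of length ℓ, and add a part ℓ − a) is a bijection from the partitions of a + N with rank ≤ 1 − a
-- onto the partitions of N with rank > −2 − a. Strong induction on n gives f_a = g_a, and a = 3 is
-- the theorem. The counts are taken through bijections with Fin: the partitions of n form a
-- decidable subset of the finite set of lists of at most n entries, each below n + 1.

module Submission where

open import Defs
open import Data.Bool using (Bool; true; false; T; not; _∧_; _∨_)
open import Data.Bool.Properties using (T-irrelevant; T-∧; ∨-zeroʳ)
open import Data.Empty using (⊥; ⊥-elim)
open import Data.Fin using (Fin; zero; suc; fromℕ<)
import Data.Fin as Fin
open import Data.Fin.Permutation using (↔⇒≡)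
open import Data.Fin.Properties using (0↔⊥; 1↔⊤; +↔⊎; *↔×; toℕ<n; toℕ-fromℕ<; fromℕ<-toℕ)
open import Data.Integer as ℤ using (-[1+_]; _⊖_)
open import Data.Integer.Properties using ([+m]-[+n]≡m⊖n; [1+m]⊖[1+n]≡m⊖n)
open import Data.List using (List; []; _∷_; length; replicate)
open import Data.List.Properties using (length-replicate)
open import Data.List.Relation.Unary.All as All using (All; []; _∷_)
open import Data.List.Relation.Unary.All.Properties using (replicate⁺)
open import Data.Nat using (ℕ; zero; suc; _+_; _*_; _∸_; pred; _%_; NonZero; >-nonZero⁻¹)
open import Data.Nat using (_≤_; _<_; _<ᵇ_; _≤ᵇ_; _≡ᵇ_; z≤n; s≤s; s≤s⁻¹; z<s; _≤?_; _<?_; _≟_)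
open import Data.Nat.DivMod using (%-distribˡ-+; m<n⇒m%n≡m; m%n<n; [m+n]%n≡m%n)
open import Data.Nat.Induction using (<-rec)
open import Data.Nat.ListAction using (sum)
open import Data.Nat.Properties
open import Algebra.Properties.CommutativeSemigroup +-commutativeSemigroup using (x∙yz≈y∙xz)
open import Data.Nat.Tactic.RingSolver using (solve-∀)
open import Data.Product using (Σ; ∃; _×_; _,_; proj₁; proj₂; uncurry)
open import Data.Product.Function.Dependent.Propositional using (Σ-↔)
open import Data.Product.Function.NonDependent.Propositional using (_×-↔_)
open import Data.Sum using (_⊎_; inj₁; inj₂)
open import Data.Sum.Function.Propositional using (_⊎-↔_)
open import Data.Unit using (⊤; tt)
open import Function using (_∘_; id)
open import Function.Bundles using (_↔_; Inverse; Equivalence; mk↔ₛ′)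
open import Function.Properties.Inverse using (↔-refl; ↔-sym; ↔-trans)
open import Function.Related.Propositional using (module EquationalReasoning)
open import Function.Related.TypeIsomorphisms using (Σ-distribʳ-⊎)
open import Relation.Binary.PropositionalEquality
open import Relation.Nullary using (Dec; does; _because_; yes; no; ¬_)
open import Relation.Nullary.Decidable using (⌊_⌋; dec-true; dec-false)


T-∧⁺ : ∀ {a b} → T a → T b → T (a ∧ b)
T-∧⁺ p q = Equivalence.from T-∧ (p , q)

T-∧⁻ : ∀ {a b} → T (a ∧ b) → T a × T b
T-∧⁻ = Equivalence.to T-∧

not-T⁺ : ∀ {b} → ¬ T b → T (not b)
not-T⁺ {false} _  = tt
not-T⁺ {true}  ¬t = ¬t tt

not-T⁻ : ∀ {b} → T (not b) → ¬ T b
not-T⁻ {false} _ ()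

≡ᵇ-true : ∀ {m n} → m ≡ n → (m ≡ᵇ n) ≡ true
≡ᵇ-true {m} {n} = dec-true (m ≟ n)

≡ᵇ-false : ∀ {m n} → m ≢ n → (m ≡ᵇ n) ≡ false
≡ᵇ-false {m} {n} = dec-false (m ≟ n)

≡ᵇ-dichotomy : ∀ {x u v} → u ≢ v → x ≡ u ⊎ x ≡ v → (x ≡ᵇ v) ≡ not (x ≡ᵇ u)
≡ᵇ-dichotomy {u = u}     u≢v (inj₁ refl) rewrite ≡ᵇ-true {u} refl | ≡ᵇ-false u≢v         = refl
≡ᵇ-dichotomy {u = u} {v} u≢v (inj₂ refl) rewrite ≡ᵇ-true {v} refl | ≡ᵇ-false (u≢v ∘ sym) = refl

<ᵇ-suc : ∀ x y → (x <ᵇ suc y) ≡ (x ≤ᵇ y)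
<ᵇ-suc zero    y = refl
<ᵇ-suc (suc x) y = refl

⌊⌋≡does : ∀ {P : Set} (p? : Dec P) → ⌊ p? ⌋ ≡ does p?
⌊⌋≡does (true  because _) = refl
⌊⌋≡does (false because _) = refl


-- Counting decidable subsets of finite types

Σᵀ-≡ : {A : Set} {P : A → Bool} {a a′ : A} {p : T (P a)} {p′ : T (P a′)} →
       a ≡ a′ → _≡_ {A = Σ A (T ∘ P)} (a , p) (a′ , p′)
Σᵀ-≡ refl = cong (_ ,_) (T-irrelevant _ _)

restrict-↔ : {A B : Set} {P : A → Bool} {Q : B → Bool} (f : A → B) (g : B → A) →
             (∀ {a} → T (P a) → T (Q (f a))) → (∀ {b} → T (Q b) → T (P (g b))) →
             (∀ {a} → T (P a) → g (f a) ≡ a) → (∀ {b} → T (Q b) → f (g b) ≡ b) →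
             Σ A (T ∘ P) ↔ Σ B (T ∘ Q)
restrict-↔ f g f-maps g-maps g∘f f∘g = mk↔ₛ′
  (λ (a , p) → f a , f-maps p) (λ (b , q) → g b , g-maps q)
  (λ (b , q) → Σᵀ-≡ (f∘g q)) (λ (a , p) → Σᵀ-≡ (g∘f p))

Σ-⊆-↔ : {A : Set} {F R : A → Bool} → (∀ {a} → T (R a) → T (F a)) →
        Σ A (T ∘ R) ↔ Σ (Σ A (T ∘ F)) (T ∘ R ∘ proj₁)
Σ-⊆-↔ R⇒F = mk↔ₛ′ (λ (a , r) → (a , R⇒F r) , r) (λ ((a , _) , r) → a , r)
  (λ ((a , f) , r) → cong (λ f → (a , f) , r) (T-irrelevant _ _)) (λ _ → refl)

toℕ : Bool → ℕ
toℕ false = 0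
toℕ true  = 1

T↔Fin : (b : Bool) → T b ↔ Fin (toℕ b)
T↔Fin false = ↔-sym 0↔⊥
T↔Fin true  = ↔-sym 1↔⊤

countᶠ : ∀ {k} → (Fin k → Bool) → ℕ
countᶠ {zero}  Q = 0
countᶠ {suc k} Q = toℕ (Q zero) + countᶠ (Q ∘ suc)

Fin-suc↔⊤⊎Fin : ∀ {k} → Fin (suc k) ↔ (⊤ ⊎ Fin k)
Fin-suc↔⊤⊎Fin = ↔-trans +↔⊎ (1↔⊤ ⊎-↔ ↔-refl)

⊤×↔ : {A : Set} → (⊤ × A) ↔ A
⊤×↔ = mk↔ₛ′ proj₂ (tt ,_) (λ _ → refl) (λ _ → refl)

Σ-Fin↔Fin : ∀ {k} (Q : Fin k → Bool) → Σ (Fin k) (T ∘ Q) ↔ Fin (countᶠ Q)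
Σ-Fin↔Fin {zero}  Q = mk↔ₛ′ (λ ()) (λ ()) (λ ()) (λ ())
Σ-Fin↔Fin {suc k} Q = begin
  Σ (Fin (suc k)) (T ∘ Q)                             ↔⟨ Σ-↔ (↔-sym Fin-suc↔⊤⊎Fin) ↔-refl ⟨
  Σ (⊤ ⊎ Fin k) (T ∘ Q ∘ Inverse.from Fin-suc↔⊤⊎Fin)  ↔⟨ Σ-distribʳ-⊎ ⟩
  ((⊤ × T (Q zero)) ⊎ Σ (Fin k) (T ∘ Q ∘ suc))        ↔⟨ ↔-trans ⊤×↔ (T↔Fin (Q zero)) ⊎-↔ Σ-Fin↔Fin (Q ∘ suc) ⟩
  (Fin (toℕ (Q zero)) ⊎ Fin (countᶠ (Q ∘ suc)))       ↔⟨ +↔⊎ ⟨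
  Fin (countᶠ Q)                                      ∎
  where open EquationalReasoning

countᶠ-complement : ∀ {k} (Q : Fin k → Bool) → countᶠ Q + countᶠ (not ∘ Q) ≡ k
countᶠ-complement {zero}  Q = refl
countᶠ-complement {suc k} Q with Q zero
... | true  = cong suc (countᶠ-complement (Q ∘ suc))
... | false = trans (+-suc _ _) (cong suc (countᶠ-complement (Q ∘ suc)))

Σ-finite↔Fin : {A : Set} {k : ℕ} (e : A ↔ Fin k) (Q : A → Bool) →
               Σ A (T ∘ Q) ↔ Fin (countᶠ (Q ∘ Inverse.from e))
Σ-finite↔Fin e Q = ↔-trans (↔-sym (Σ-↔ (↔-sym e) ↔-refl)) (Σ-Fin↔Fin _)

fitsIn : ℕ → ℕ → List ℕ → Bool
fitsIn ℓ       b []       = true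
fitsIn zero    b (x ∷ xs) = false
fitsIn (suc ℓ) b (x ∷ xs) = (x <ᵇ b) ∧ fitsIn ℓ b xs

boxSize : ℕ → ℕ → ℕ
boxSize zero    b = 1
boxSize (suc ℓ) b = 1 + b * boxSize ℓ b

Σ<ᵇ↔Fin : ∀ b → Σ ℕ (λ x → T (x <ᵇ b)) ↔ Fin b
Σ<ᵇ↔Fin b = mk↔ₛ′ (λ (x , x<b) → fromℕ< (<ᵇ⇒< x b x<b)) (λ i → Fin.toℕ i , <⇒<ᵇ (toℕ<n i))
  (λ i → fromℕ<-toℕ i _) (λ _ → Σᵀ-≡ (toℕ-fromℕ< _))

fitsIn-suc↔ : ∀ ℓ b → Σ (List ℕ) (T ∘ fitsIn (suc ℓ) b) ↔
              (⊤ ⊎ (Σ ℕ (λ x → T (x <ᵇ b)) × Σ (List ℕ) (T ∘ fitsIn ℓ b)))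
fitsIn-suc↔ ℓ b = mk↔ₛ′ to from to∘from from∘to
  where
  to : Σ (List ℕ) (T ∘ fitsIn (suc ℓ) b) → ⊤ ⊎ (Σ ℕ (λ x → T (x <ᵇ b)) × Σ (List ℕ) (T ∘ fitsIn ℓ b))
  to ([]     , _) = inj₁ tt
  to (x ∷ xs , h) = inj₂ ((x , proj₁ (T-∧⁻ h)) , (xs , proj₂ (T-∧⁻ h)))
  from : ⊤ ⊎ (Σ ℕ (λ x → T (x <ᵇ b)) × Σ (List ℕ) (T ∘ fitsIn ℓ b)) → Σ (List ℕ) (T ∘ fitsIn (suc ℓ) b)
  from (inj₁ _)                    = [] , tt
  from (inj₂ ((x , p) , (xs , q))) = x ∷ xs , T-∧⁺ p q
  to∘from : ∀ y → to (from y) ≡ y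
  to∘from (inj₁ tt) = refl
  to∘from (inj₂ ((x , p) , (xs , q))) =
    cong₂ (λ p q → inj₂ ((x , p) , (xs , q))) (T-irrelevant _ _) (T-irrelevant _ _)
  from∘to : ∀ y → from (to y) ≡ y
  from∘to ([]     , _) = refl
  from∘to (x ∷ xs , _) = Σᵀ-≡ refl

fitsIn↔Fin : ∀ ℓ b → Σ (List ℕ) (T ∘ fitsIn ℓ b) ↔ Fin (boxSize ℓ b)
fitsIn↔Fin zero    b = mk↔ₛ′ (λ _ → zero) (λ _ → [] , tt)
  (λ { zero → refl }) (λ { ([] , tt) → refl ; (_ ∷ _ , ()) })
fitsIn↔Fin (suc ℓ) b = begin
  Σ (List ℕ) (T ∘ fitsIn (suc ℓ) b)                                ↔⟨ fitsIn-suc↔ ℓ b ⟩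
  (⊤ ⊎ (Σ ℕ (λ x → T (x <ᵇ b)) × Σ (List ℕ) (T ∘ fitsIn ℓ b)))     ↔⟨ ↔-sym 1↔⊤ ⊎-↔ (Σ<ᵇ↔Fin b ×-↔ fitsIn↔Fin ℓ b) ⟩
  (Fin 1 ⊎ (Fin b × Fin (boxSize ℓ b)))                            ↔⟨ ↔-refl ⊎-↔ *↔× ⟨
  (Fin 1 ⊎ Fin (b * boxSize ℓ b))                                  ↔⟨ +↔⊎ ⟨
  Fin (boxSize (suc ℓ) b)                                          ∎
  where open EquationalReasoning

fitsIn⁺ : ∀ {ℓ b} xs → length xs ≤ ℓ → All (_< b) xs → T (fitsIn ℓ b xs)
fitsIn⁺ []       _       _            = tt
fitsIn⁺ (x ∷ xs) (s≤s l) (x<b ∷ xs<b) = T-∧⁺ (<⇒<ᵇ x<b) (fitsIn⁺ xs l xs<b)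


-- Partitions of n and their number

allPositive⁻ : ∀ xs → T (allPositive xs) → All (0 <_) xs
allPositive⁻ []       _ = []
allPositive⁻ (x ∷ xs) h = <ᵇ⇒< 0 x (proj₁ (T-∧⁻ h)) ∷ allPositive⁻ xs (proj₂ (T-∧⁻ h))

allPositive⁺ : ∀ {xs} → All (0 <_) xs → T (allPositive xs)
allPositive⁺ []         = tt
allPositive⁺ (0<x ∷ ps) = T-∧⁺ (<⇒<ᵇ 0<x) (allPositive⁺ ps)

nonincreasing-∷⁻ : ∀ x xs → T (nonincreasing (x ∷ xs)) → All (_≤ x) xs × T (nonincreasing xs)
nonincreasing-∷⁻ x []       _ = [] , tt
nonincreasing-∷⁻ x (y ∷ ys) h with T-∧⁻ h
... | y≤ᵇx , sorted with ≤ᵇ⇒≤ y x y≤ᵇx | nonincreasing-∷⁻ y ys sorted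
...   | y≤x | ys≤y , _ = (y≤x ∷ All.map (λ z≤y → ≤-trans z≤y y≤x) ys≤y) , sorted

nonincreasing-∷⁺ : ∀ {x} xs → All (_≤ x) xs → T (nonincreasing xs) → T (nonincreasing (x ∷ xs))
nonincreasing-∷⁺ []       _         _      = tt
nonincreasing-∷⁺ (y ∷ ys) (y≤x ∷ _) sorted = T-∧⁺ (≤⇒≤ᵇ y≤x) sorted

record IsPartition (n : ℕ) (π : List ℕ) : Set where
  constructor mkIsPartition
  field
    positive : All (0 <_) π
    sorted   : T (nonincreasing π)
    sums-to  : sum π ≡ n

isPartition⁻ : ∀ {n} π → T (isPartition n π) → IsPartition n π
isPartition⁻ {n} π h with T-∧⁻ h
... | pos , h′ with T-∧⁻ {nonincreasing π} h′
...   | sorted , s = mkIsPartition (allPositive⁻ π pos) sorted (≡ᵇ⇒≡ (sum π) n s)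

isPartition⁺ : ∀ {n π} → IsPartition n π → T (isPartition n π)
isPartition⁺ {n} {π} (mkIsPartition pos sorted s) =
  T-∧⁺ (allPositive⁺ pos) (T-∧⁺ sorted (≡⇒≡ᵇ (sum π) n s))

length≤sum : ∀ {xs} → All (0 <_) xs → length xs ≤ sum xs
length≤sum []         = z≤n
length≤sum (0<x ∷ ps) = +-mono-≤ 0<x (length≤sum ps)

parts≤sum : ∀ xs → All (_≤ sum xs) xs
parts≤sum []       = []
parts≤sum (x ∷ xs) = m≤m+n x (sum xs) ∷ All.map (λ y≤ → ≤-trans y≤ (m≤n+m (sum xs) x)) (parts≤sum xs)

isPartition⇒fitsIn : ∀ {n π} → T (isPartition n π) → T (fitsIn n (suc n) π)
isPartition⇒fitsIn {n} {π} h with isPartition⁻ π h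
... | mkIsPartition pos _ refl = fitsIn⁺ π (length≤sum pos) (All.map s≤s (parts≤sum π))

Partition : ℕ → Set
Partition n = Σ (List ℕ) (T ∘ isPartition n)

partitionCount : ℕ → ℕ
partitionCount n = countᶠ (isPartition n ∘ proj₁ ∘ Inverse.from (fitsIn↔Fin n (suc n)))

Partition↔Fin : ∀ n → Partition n ↔ Fin (partitionCount n)
Partition↔Fin n =
  ↔-trans (Σ-⊆-↔ (λ {π} → isPartition⇒fitsIn {n} {π})) (Σ-finite↔Fin (fitsIn↔Fin n (suc n)) _)

#partitions : ℕ → (List ℕ → Bool) → ℕ
#partitions n Q = countᶠ (Q ∘ proj₁ ∘ Inverse.from (Partition↔Fin n))

PartitionsWith↔Σ : ∀ n Q → PartitionsWith n Q ↔ Σ (Partition n) (T ∘ Q ∘ proj₁)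
PartitionsWith↔Σ n Q = mk↔ₛ′
  (λ (π , h) → (π , proj₁ (T-∧⁻ h)) , proj₂ (T-∧⁻ h)) (λ ((π , p) , q) → π , T-∧⁺ p q)
  (λ ((π , _) , _) → cong₂ (λ p q → (π , p) , q) (T-irrelevant _ _) (T-irrelevant _ _))
  (λ _ → Σᵀ-≡ refl)

PartitionsWith↔Fin : ∀ n Q → PartitionsWith n Q ↔ Fin (#partitions n Q)
PartitionsWith↔Fin n Q = ↔-trans (PartitionsWith↔Σ n Q) (Σ-finite↔Fin (Partition↔Fin n) (Q ∘ proj₁))

PartitionsWith-↔ : ∀ {m n P Q} (f g : List ℕ → List ℕ) →
  (∀ {π} → IsPartition m π → T (P π) → IsPartition n (f π) × T (Q (f π))) →
  (∀ {π} → IsPartition n π → T (Q π) → IsPartition m (g π) × T (P (g π))) →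
  (∀ {π} → IsPartition m π → T (P π) → g (f π) ≡ π) →
  (∀ {π} → IsPartition n π → T (Q π) → f (g π) ≡ π) →
  PartitionsWith m P ↔ PartitionsWith n Q
PartitionsWith-↔ {m} {n} {P} {Q} f g f-maps g-maps g∘f f∘g = restrict-↔ f g
  (λ {π} h → join Q (f π) (uncurry (f-maps {π}) (split P π h)))
  (λ {π} h → join P (g π) (uncurry (g-maps {π}) (split Q π h)))
  (λ {π} h → uncurry (g∘f {π}) (split P π h))
  (λ {π} h → uncurry (f∘g {π}) (split Q π h))
  where
  split : ∀ {k} R π → T (isPartition k π ∧ R π) → IsPartition k π × T (R π)
  split R π h = isPartition⁻ π (proj₁ (T-∧⁻ h)) , proj₂ (T-∧⁻ {isPartition _ π} h)
  join : ∀ {k} R π → IsPartition k π × T (R π) → T (isPartition k π ∧ R π)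
  join R π (isp , r) = T-∧⁺ (isPartition⁺ isp) r

PartitionsWith-cong : ∀ {n P Q} → (∀ π → P π ≡ Q π) → PartitionsWith n P ↔ PartitionsWith n Q
PartitionsWith-cong P≗Q = PartitionsWith-↔ id id
  (λ isp p → isp , subst T (P≗Q _) p) (λ isp q → isp , subst T (sym (P≗Q _)) q) (λ _ _ → refl) (λ _ _ → refl)

#partitions-complement : ∀ n Q → #partitions n Q + #partitions n (not ∘ Q) ≡ partitionCount n
#partitions-complement n Q = countᶠ-complement _

↔⇒#partitions≡ : ∀ {m n P Q} → PartitionsWith m P ↔ PartitionsWith n Q → #partitions m P ≡ #partitions n Q
↔⇒#partitions≡ {m} {n} {P} {Q} e =
  ↔⇒≡ (↔-trans (↔-sym (PartitionsWith↔Fin m P)) (↔-trans e (PartitionsWith↔Fin n Q)))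

#partitions-recurrence : ∀ {m n P Q} → PartitionsWith m (not ∘ P) ↔ PartitionsWith n Q →
                         #partitions n Q + #partitions m P ≡ partitionCount m
#partitions-recurrence {m} {n} {P} {Q} e = begin
  #partitions n Q + #partitions m P       ≡⟨ cong (_+ #partitions m P) (sym (↔⇒#partitions≡ e)) ⟩
  #partitions m (not ∘ P) + #partitions m P ≡⟨ +-comm _ (#partitions m P) ⟩
  #partitions m P + #partitions m (not ∘ P) ≡⟨ #partitions-complement m P ⟩
  partitionCount m                          ∎
  where open ≡-Reasoning

#partitions-none : ∀ {n Q} → (∀ {π} → IsPartition n π → T (Q π) → ⊥) → #partitions n Q ≡ 0
#partitions-none {n} {Q} none = ↔⇒≡ (↔-trans (↔-sym (PartitionsWith↔Fin n Q)) empty)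
  where
  impossible : PartitionsWith n Q → ⊥
  impossible (π , h) = none (isPartition⁻ π (proj₁ (T-∧⁻ h))) (proj₂ (T-∧⁻ h))
  empty : PartitionsWith n Q ↔ Fin 0
  empty = mk↔ₛ′ (⊥-elim ∘ impossible) (λ ()) (λ ()) (⊥-elim ∘ impossible)


-- Inserting and removing a part

∈ᵇ-tail : ∀ {a x} xs → a ≢ x → T (a ∈ᵇ (x ∷ xs)) → T (a ∈ᵇ xs)
∈ᵇ-tail xs a≢x a∈ rewrite ≡ᵇ-false a≢x = a∈

∈ᵇ-All : ∀ {P : ℕ → Set} {a} xs → T (a ∈ᵇ xs) → All P xs → P a
∈ᵇ-All {a = a} (x ∷ xs) a∈ (px ∷ pxs) with a ≟ x
... | yes refl = px
... | no a≢x   = ∈ᵇ-All xs (∈ᵇ-tail xs a≢x a∈) pxs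

insert : ℕ → List ℕ → List ℕ
insert a []       = a ∷ []
insert a (x ∷ xs) with x ≤? a
... | yes _ = a ∷ x ∷ xs
... | no  _ = x ∷ insert a xs

remove : ℕ → List ℕ → List ℕ
remove a []       = []
remove a (x ∷ xs) with x ≟ a
... | yes _ = xs
... | no  _ = x ∷ remove a xs

length-insert : ∀ a xs → length (insert a xs) ≡ suc (length xs)
length-insert a []       = refl
length-insert a (x ∷ xs) with x ≤? a
... | yes _ = refl
... | no  _ = cong suc (length-insert a xs)

sum-insert : ∀ a xs → sum (insert a xs) ≡ a + sum xs
sum-insert a []       = refl
sum-insert a (x ∷ xs) with x ≤? a
... | yes _ = refl
... | no  _ = trans (cong (x +_) (sum-insert a xs)) (x∙yz≈y∙xz x a (sum xs))

sum-remove : ∀ a xs → T (a ∈ᵇ xs) → a + sum (remove a xs) ≡ sum xs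
sum-remove a (x ∷ xs) a∈ with x ≟ a
... | yes refl = refl
... | no x≢a   =
  trans (x∙yz≈y∙xz a x _) (cong (x +_) (sum-remove a xs (∈ᵇ-tail xs (x≢a ∘ sym) a∈)))

All-insert : ∀ {P : ℕ → Set} {a} xs → P a → All P xs → All P (insert a xs)
All-insert         []       pa _   = pa ∷ []
All-insert {a = a} (x ∷ xs) pa pxs with x ≤? a
... | yes _ = pa ∷ pxs
... | no  _ = All.head pxs ∷ All-insert xs pa (All.tail pxs)

All-remove : ∀ {P : ℕ → Set} {a} xs → All P xs → All P (remove a xs)
All-remove         []       _   = []
All-remove {a = a} (x ∷ xs) pxs with x ≟ a
... | yes _ = All.tail pxs
... | no  _ = All.head pxs ∷ All-remove xs (All.tail pxs)

sorted-insert : ∀ a xs → T (nonincreasing xs) → T (nonincreasing (insert a xs))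
sorted-insert a []       _      = tt
sorted-insert a (x ∷ xs) sorted with x ≤? a | nonincreasing-∷⁻ x xs sorted
... | yes x≤a | _           = T-∧⁺ (≤⇒≤ᵇ x≤a) sorted
... | no  x≰a | xs≤x , xs-sorted =
  nonincreasing-∷⁺ (insert a xs) (All-insert xs (≰⇒≥ x≰a) xs≤x) (sorted-insert a xs xs-sorted)

sorted-remove : ∀ a xs → T (nonincreasing xs) → T (nonincreasing (remove a xs))
sorted-remove a []       _      = tt
sorted-remove a (x ∷ xs) sorted with x ≟ a | nonincreasing-∷⁻ x xs sorted
... | yes _ | _                = proj₂ (nonincreasing-∷⁻ x xs sorted)
... | no  _ | xs≤x , xs-sorted =
  nonincreasing-∷⁺ (remove a xs) (All-remove xs xs≤x) (sorted-remove a xs xs-sorted)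

∈ᵇ-insert : ∀ a xs → (a ∈ᵇ insert a xs) ≡ true
∈ᵇ-insert a []       rewrite ≡ᵇ-true {a} refl = refl
∈ᵇ-insert a (x ∷ xs) with x ≤? a
... | yes _ rewrite ≡ᵇ-true {a} refl = refl
... | no  _ rewrite ∈ᵇ-insert a xs = ∨-zeroʳ (a ≡ᵇ x)

∈ᵇ-insert-≢ : ∀ {y a} xs → y ≢ a → (y ∈ᵇ insert a xs) ≡ (y ∈ᵇ xs)
∈ᵇ-insert-≢         []       y≢a rewrite ≡ᵇ-false y≢a = refl
∈ᵇ-insert-≢ {y} {a} (x ∷ xs) y≢a with x ≤? a
... | yes _ rewrite ≡ᵇ-false y≢a = refl
... | no  _ = cong ((y ≡ᵇ x) ∨_) (∈ᵇ-insert-≢ xs y≢a)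

remove-∷ : ∀ a xs → remove a (a ∷ xs) ≡ xs
remove-∷ a xs with a ≟ a
... | yes _   = refl
... | no  a≢a = ⊥-elim (a≢a refl)

remove-insert : ∀ a xs → remove a (insert a xs) ≡ xs
remove-insert a []       = remove-∷ a []
remove-insert a (x ∷ xs) with x ≤? a
... | yes _   = remove-∷ a (x ∷ xs)
... | no  x≰a with x ≟ a
...   | yes refl = ⊥-elim (x≰a ≤-refl)
...   | no  _    = cong (x ∷_) (remove-insert a xs)

insert-∷ : ∀ {a} xs → All (_≤ a) xs → insert a xs ≡ a ∷ xs
insert-∷         []       _         = refl
insert-∷ {a} (x ∷ xs) (x≤a ∷ _) with x ≤? a
... | yes _   = refl
... | no  x≰a = ⊥-elim (x≰a x≤a)

insert-remove : ∀ a xs → T (nonincreasing xs) → T (a ∈ᵇ xs) → insert a (remove a xs) ≡ xs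
insert-remove a (x ∷ xs) sorted a∈ with x ≟ a | nonincreasing-∷⁻ x xs sorted
... | yes refl | xs≤x , _ = insert-∷ xs xs≤x
... | no  x≢a  | xs≤x , xs-sorted with x ≤? a
...   | yes x≤a = ⊥-elim (x≢a (≤-antisym x≤a (∈ᵇ-All xs a∈xs xs≤x)))
  where a∈xs = ∈ᵇ-tail xs (x≢a ∘ sym) a∈
...   | no  _   = cong (x ∷_) (insert-remove a xs xs-sorted (∈ᵇ-tail xs (x≢a ∘ sym) a∈))

insert-isPartition : ∀ {a n ρ} → 0 < a → IsPartition n ρ → IsPartition (a + n) (insert a ρ)
insert-isPartition {a} {ρ = ρ} 0<a (mkIsPartition pos sorted refl) =
  mkIsPartition (All-insert ρ 0<a pos) (sorted-insert a ρ sorted) (sum-insert a ρ)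

remove-isPartition : ∀ {a n π} → T (a ∈ᵇ π) → IsPartition (a + n) π → IsPartition n (remove a π)
remove-isPartition {a} {π = π} a∈ (mkIsPartition pos sorted s) =
  mkIsPartition (All-remove π pos) (sorted-remove a π sorted)
                (+-cancelˡ-≡ a _ _ (trans (sum-remove a π a∈) s))


-- The mex recurrence

module _ (A : ℕ) .{{_ : NonZero A}} where

  private instance
    2A≢0 : NonZero (2 * A)
    2A≢0 = m*n≢0 2 A

  private
    0<A : 0 < A
    0<A = >-nonZero⁻¹ A

    2A≡A+A : 2 * A ≡ A + A
    2A≡A+A = cong (A +_) (+-identityʳ A)

    A<2A : A < 2 * A
    A<2A = subst (A <_) (sym 2A≡A+A) (m<m+n A 0<A)

  r≢[r+A]%2A : ∀ {r} → r < 2 * A → r ≢ (r + A) % (2 * A)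
  r≢[r+A]%2A {r} r<2A eq with r <? A
  ... | yes r<A = <-irrefl (trans eq (m<n⇒m%n≡m r+A<2A)) (m<m+n r 0<A)
    where r+A<2A = subst (r + A <_) (sym 2A≡A+A) (+-monoˡ-< A r<A)
  ... | no  r≮A = <-irrefl (sym (trans eq [r+A]%2A≡r∸A)) (∸-monoʳ-< 0<A A≤r)
    where
    A≤r = ≮⇒≥ r≮A
    r+A≡r∸A+2A : r + A ≡ (r ∸ A) + 2 * A
    r+A≡r∸A+2A = trans (cong (_+ A) (sym (m∸n+n≡m A≤r))) (lemma (r ∸ A) A)
      where lemma : ∀ s a → s + a + a ≡ s + 2 * a
            lemma = solve-∀
    [r+A]%2A≡r∸A : (r + A) % (2 * A) ≡ r ∸ A
    [r+A]%2A≡r∸A = begin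
      (r + A) % (2 * A)           ≡⟨ cong (_% (2 * A)) r+A≡r∸A+2A ⟩
      (r ∸ A + 2 * A) % (2 * A)   ≡⟨ [m+n]%n≡m%n (r ∸ A) (2 * A) ⟩
      (r ∸ A) % (2 * A)           ≡⟨ m<n⇒m%n≡m (≤-<-trans (m∸n≤m r A) r<2A) ⟩
      r ∸ A                       ∎
      where open ≡-Reasoning

  c%2A≢[A+c]%2A : ∀ c → c % (2 * A) ≢ (A + c) % (2 * A)
  c%2A≢[A+c]%2A c eq = r≢[r+A]%2A (m%n<n c (2 * A)) (begin
    c % (2 * A)                            ≡⟨ eq ⟩
    (A + c) % (2 * A)                      ≡⟨ cong (_% (2 * A)) (+-comm A c) ⟩
    (c + A) % (2 * A)                      ≡⟨ %-distribˡ-+ c A (2 * A) ⟩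
    (c % (2 * A) + A % (2 * A)) % (2 * A)  ≡⟨ cong (λ a → (c % (2 * A) + a) % (2 * A)) (m<n⇒m%n≡m A<2A) ⟩
    (c % (2 * A) + A) % (2 * A)            ∎)
    where open ≡-Reasoning

  [c+[2+j]A]%2A : ∀ c j → (c + (2 + j) * A) % (2 * A) ≡ (c + j * A) % (2 * A)
  [c+[2+j]A]%2A c j = trans (cong (_% (2 * A)) (regroup c j A)) ([m+n]%n≡m%n (c + j * A) (2 * A))
    where
    regroup : ∀ c j a → c + (2 + j) * a ≡ (c + j * a) + 2 * a
    regroup = solve-∀

  [c+jA]%2A≡c%2A⊎[A+c]%2A : ∀ c j → (c + j * A) % (2 * A) ≡ c % (2 * A) ⊎ (c + j * A) % (2 * A) ≡ (A + c) % (2 * A)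
  [c+jA]%2A≡c%2A⊎[A+c]%2A c zero          = inj₁ (cong (_% (2 * A)) (+-identityʳ c))
  [c+jA]%2A≡c%2A⊎[A+c]%2A c (suc zero)    = inj₂ (cong (_% (2 * A)) (trans (cong (c +_) (+-identityʳ A)) (+-comm c A)))
  [c+jA]%2A≡c%2A⊎[A+c]%2A c (suc (suc j)) rewrite [c+[2+j]A]%2A c j = [c+jA]%2A≡c%2A⊎[A+c]%2A c j

  mexGo≡c+jA : ∀ f c π → ∃ λ j → mexGo f A c π ≡ c + j * A
  mexGo≡c+jA zero    c π = 0 , sym (+-identityʳ c)
  mexGo≡c+jA (suc f) c π with c ∈ᵇ π
  ... | false = 0 , sym (+-identityʳ c)
  ... | true with mexGo≡c+jA f (c + A) π
  ...   | j , eq = suc j , trans eq (+-assoc c A (j * A))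

  mexGo-cong : ∀ f c π ρ → (∀ {y} → c ≤ y → (y ∈ᵇ π) ≡ (y ∈ᵇ ρ)) → mexGo f A c π ≡ mexGo f A c ρ
  mexGo-cong zero    c π ρ _     = refl
  mexGo-cong (suc f) c π ρ agree rewrite agree (≤-refl {c}) with c ∈ᵇ ρ
  ... | false = refl
  ... | true  = mexGo-cong f (c + A) π ρ (λ c+A≤y → agree (≤-trans (m≤m+n c A) c+A≤y))

  mexGo-∉ : ∀ f a π → (a ∈ᵇ π) ≡ false → mexGo f A a π ≡ a
  mexGo-∉ zero    a π _  = refl
  mexGo-∉ (suc f) a π a∉ rewrite a∉ = refl

  mex-insert : ∀ a ρ → mex A a (insert a ρ) ≡ mex A (a + A) ρ
  mex-insert a ρ rewrite length-insert a ρ | ∈ᵇ-insert a ρ =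
    mexGo-cong (length ρ) (a + A) (insert a ρ) ρ
      (λ a+A≤y → ∈ᵇ-insert-≢ ρ (λ y≡a → <⇒≱ (m<m+n a 0<A) (subst (a + A ≤_) y≡a a+A≤y)))

  mexCond-insert : ∀ a ρ → mexCond A a (insert a ρ) ≡ not (mexCond A (a + A) ρ)
  mexCond-insert a ρ with mexGo≡c+jA (length ρ) (a + A) ρ
  ... | j , mex≡ = begin
    mexCond A a (insert a ρ)        ≡⟨ cong (λ x → x % (2 * A) ≡ᵇ (A + a) % (2 * A)) (mex-insert a ρ) ⟩
    (r ≡ᵇ (A + a) % (2 * A))        ≡⟨ ≡ᵇ-dichotomy (c%2A≢[A+c]%2A a) r-cases ⟩
    not (r ≡ᵇ a % (2 * A))          ≡⟨ cong (λ c → not (r ≡ᵇ c)) (sym [A+[a+A]]%2A≡a%2A) ⟩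
    not (mexCond A (a + A) ρ)       ∎
    where
    open ≡-Reasoning
    r = mex A (a + A) ρ % (2 * A)
    regroup : ∀ a j x → a + x + j * x ≡ a + suc j * x
    regroup = solve-∀
    r-cases : r ≡ a % (2 * A) ⊎ r ≡ (A + a) % (2 * A)
    r-cases = subst (λ x → x % (2 * A) ≡ a % (2 * A) ⊎ x % (2 * A) ≡ (A + a) % (2 * A))
                    (sym (trans mex≡ (regroup a j A))) ([c+jA]%2A≡c%2A⊎[A+c]%2A a (suc j))
    [A+[a+A]]%2A≡a%2A : (A + (a + A)) % (2 * A) ≡ a % (2 * A)
    [A+[a+A]]%2A≡a%2A = trans (cong (_% (2 * A)) (lemma A a)) ([m+n]%n≡m%n a (2 * A))
      where lemma : ∀ x a → x + (a + x) ≡ a + 2 * x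
            lemma = solve-∀

  mexCond⇒∈ᵇ : ∀ a π → T (mexCond A a π) → T (a ∈ᵇ π)
  mexCond⇒∈ᵇ a π h with a ∈ᵇ π in a∈π
  ... | true  = tt
  ... | false = subst T (≡ᵇ-false (c%2A≢[A+c]%2A a))
                        (subst (λ x → T (x % (2 * A) ≡ᵇ (A + a) % (2 * A))) (mexGo-∉ (length π) a π a∈π) h)

  mexCond-insert-↔ : ∀ a m → 0 < a →
    PartitionsWith m (not ∘ mexCond A (a + A)) ↔ PartitionsWith (a + m) (mexCond A a)
  mexCond-insert-↔ a m 0<a = PartitionsWith-↔ (insert a) (remove a)
    (λ {ρ} isp h → insert-isPartition 0<a isp , subst T (sym (mexCond-insert a ρ)) h)
    (λ {π} isp h → remove-isPartition (mexCond⇒∈ᵇ a π h) isp ,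
                   subst T (trans (cong (mexCond A a) (sym (insert-remove-mexCond isp h))) (mexCond-insert a (remove a π))) h)
    (λ {ρ} _ _ → remove-insert a ρ)
    insert-remove-mexCond
    where
    insert-remove-mexCond : ∀ {π} → IsPartition (a + m) π → T (mexCond A a π) → insert a (remove a π) ≡ π
    insert-remove-mexCond {π} isp h = insert-remove a π (IsPartition.sorted isp) (mexCond⇒∈ᵇ a π h)

  #mexCond-recurrence : ∀ a m → 0 < a →
    #partitions (a + m) (mexCond A a) + #partitions m (mexCond A (a + A)) ≡ partitionCount m
  #mexCond-recurrence a m 0<a = #partitions-recurrence (mexCond-insert-↔ a m 0<a)

  #mexCond-small : ∀ {a n} → n < a → #partitions n (mexCond A a) ≡ 0
  #mexCond-small {a} {n} n<a = #partitions-none {n} {mexCond A a} (λ {π} isp h → <⇒≱ n<a (mexCond⇒a≤n isp h))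
    where
    mexCond⇒a≤n : ∀ {π} → IsPartition n π → T (mexCond A a π) → a ≤ n
    mexCond⇒a≤n {π} (mkIsPartition _ _ refl) h = ∈ᵇ-All π (mexCond⇒∈ᵇ a π h) (parts≤sum π)


largestPart-≤ : ∀ {y} xs → All (_≤ y) xs → largestPart xs ≤ y
largestPart-≤ []       []           = z≤n
largestPart-≤ (x ∷ xs) (x≤y ∷ xs≤y) = ⊔-lub x≤y (largestPart-≤ xs xs≤y)

largestPart-∷ : ∀ x xs → All (_≤ x) xs → largestPart (x ∷ xs) ≡ x
largestPart-∷ x xs xs≤x = m≥n⇒m⊔n≡m (largestPart-≤ xs xs≤x)

rank≤- : ℕ → List ℕ → Bool
rank≤- k π = (largestPart π + k) ≤ᵇ length π

⊖≤?-[1+k] : ∀ a b k → ⌊ (a ⊖ b) ℤ.≤? -[1+ k ] ⌋ ≡ (a + suc k ≤ᵇ b)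
⊖≤?-[1+k] a       zero    k rewrite +-suc a k = refl
⊖≤?-[1+k] zero    (suc b) k = trans (⌊⌋≡does (-[1+ b ] ℤ.≤? -[1+ k ])) (sym (<ᵇ-suc k b))
⊖≤?-[1+k] (suc a) (suc b) k rewrite [1+m]⊖[1+n]≡m⊖n a b = trans (⊖≤?-[1+k] a b k) (sym (<ᵇ-suc (a + suc k) b))

rank≤?-[1+k] : ∀ k π → ⌊ rank π ℤ.≤? -[1+ k ] ⌋ ≡ rank≤- (suc k) π
rank≤?-[1+k] k π =
  trans (cong (λ r → ⌊ r ℤ.≤? -[1+ k ] ⌋) ([+m]-[+n]≡m⊖n (largestPart π) (length π)))
        (⊖≤?-[1+k] (largestPart π) (length π) k)

rank≤-suc⇒2+k≤n : ∀ {k n π} → IsPartition n π → T (rank≤- (suc k) π) → 2 + k ≤ n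
rank≤-suc⇒2+k≤n {k} {π = x ∷ xs} (mkIsPartition (0<x ∷ pos) _ refl) h = begin
  2 + k                          ≤⟨ +-monoˡ-≤ (suc k) (≤-trans 0<x (m≤m⊔n x (largestPart xs))) ⟩
  largestPart (x ∷ xs) + suc k   ≤⟨ ≤ᵇ⇒≤ _ _ h ⟩
  length (x ∷ xs)                ≤⟨ length≤sum (0<x ∷ pos) ⟩
  sum (x ∷ xs)                   ∎
  where open ≤-Reasoning

#rank≤-small : ∀ {k n} → n < 2 + k → #partitions n (rank≤- (suc k)) ≡ 0
#rank≤-small {k} {n} n<2+k = #partitions-none {n} {rank≤- (suc k)} λ isp h → <⇒≱ n<2+k (rank≤-suc⇒2+k≤n isp h)


-- Columns of a Ferrers diagram

prependPart : ℕ → List ℕ → List ℕ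
prependPart zero    ys = ys
prependPart (suc k) ys = suc k ∷ ys

dropColumn : List ℕ → List ℕ
dropColumn []       = []
dropColumn (x ∷ xs) = prependPart (pred x) (dropColumn xs)

addColumn : ℕ → List ℕ → List ℕ
addColumn ℓ []       = replicate ℓ 1
addColumn ℓ (x ∷ xs) = suc x ∷ addColumn (pred ℓ) xs

positive-prependPart : ∀ k {ys} → All (0 <_) ys → All (0 <_) (prependPart k ys)
positive-prependPart zero    pos = pos
positive-prependPart (suc k) pos = z<s ∷ pos

≤-prependPart : ∀ {y} k {ys} → k ≤ y → All (_≤ y) ys → All (_≤ y) (prependPart k ys)
≤-prependPart zero    _   ys≤y = ys≤y
≤-prependPart (suc k) k≤y ys≤y = k≤y ∷ ys≤y

sorted-prependPart : ∀ k {ys} → All (_≤ k) ys → T (nonincreasing ys) → T (nonincreasing (prependPart k ys))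
sorted-prependPart zero    _    sorted = sorted
sorted-prependPart (suc k) ys≤k sorted = nonincreasing-∷⁺ _ ys≤k sorted

sum-prependPart : ∀ k ys → sum (prependPart k ys) ≡ k + sum ys
sum-prependPart zero    ys = refl
sum-prependPart (suc k) ys = refl

length-prependPart : ∀ k ys → length (prependPart k ys) ≤ suc (length ys)
length-prependPart zero    ys = n≤1+n (length ys)
length-prependPart (suc k) ys = ≤-refl

≤-largestPart-prependPart : ∀ k ys → k ≤ largestPart (prependPart k ys)
≤-largestPart-prependPart zero    ys = z≤n
≤-largestPart-prependPart (suc k) ys = m≤m⊔n (suc k) (largestPart ys)

positive-≤0⇒[] : ∀ {ys} → All (0 <_) ys → All (_≤ 0) ys → ys ≡ []
positive-≤0⇒[] []        []        = refl
positive-≤0⇒[] (0<y ∷ _) (y≤0 ∷ _) = ⊥-elim (<⇒≱ 0<y y≤0)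

positive-≤1⇒replicate : ∀ {ys} → All (0 <_) ys → All (_≤ 1) ys → ys ≡ replicate (length ys) 1
positive-≤1⇒replicate []              []               = refl
positive-≤1⇒replicate (s≤s z≤n ∷ pos) (s≤s z≤n ∷ ys≤1) = cong (1 ∷_) (positive-≤1⇒replicate pos ys≤1)

positive-dropColumn : ∀ xs → All (0 <_) (dropColumn xs)
positive-dropColumn []       = []
positive-dropColumn (x ∷ xs) = positive-prependPart (pred x) (positive-dropColumn xs)

≤-dropColumn : ∀ {y} xs → All (_≤ y) xs → All (_≤ pred y) (dropColumn xs)
≤-dropColumn []       []           = []
≤-dropColumn (x ∷ xs) (x≤y ∷ xs≤y) = ≤-prependPart (pred x) (pred-mono-≤ x≤y) (≤-dropColumn xs xs≤y)

sorted-dropColumn : ∀ xs → T (nonincreasing xs) → T (nonincreasing (dropColumn xs))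
sorted-dropColumn []       _      = tt
sorted-dropColumn (x ∷ xs) sorted with nonincreasing-∷⁻ x xs sorted
... | xs≤x , xs-sorted = sorted-prependPart (pred x) (≤-dropColumn xs xs≤x) (sorted-dropColumn xs xs-sorted)

sum-dropColumn : ∀ {xs} → All (0 <_) xs → sum (dropColumn xs) + length xs ≡ sum xs
sum-dropColumn {[]}         []        = refl
sum-dropColumn {suc x ∷ xs} (_ ∷ pos) = begin
  sum (prependPart x (dropColumn xs)) + suc (length xs)  ≡⟨ cong (_+ suc (length xs)) (sum-prependPart x _) ⟩
  x + sum (dropColumn xs) + suc (length xs)              ≡⟨ regroup x (sum (dropColumn xs)) (length xs) ⟩
  suc x + (sum (dropColumn xs) + length xs)              ≡⟨ cong (suc x +_) (sum-dropColumn pos) ⟩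
  suc x + sum xs                                         ∎
  where
  open ≡-Reasoning
  regroup : ∀ x d l → x + d + suc l ≡ suc x + (d + l)
  regroup = solve-∀

length-dropColumn : ∀ xs → length (dropColumn xs) ≤ length xs
length-dropColumn []       = z≤n
length-dropColumn (x ∷ xs) = ≤-trans (length-prependPart (pred x) _) (s≤s (length-dropColumn xs))

dropColumn-≤1 : ∀ {xs} → All (_≤ 1) xs → dropColumn xs ≡ []
dropColumn-≤1 {xs} xs≤1 = positive-≤0⇒[] (positive-dropColumn xs) (≤-dropColumn xs xs≤1)

length-addColumn : ∀ {ℓ} xs → length xs ≤ ℓ → length (addColumn ℓ xs) ≡ ℓ
length-addColumn {ℓ}     []       _       = length-replicate ℓ
length-addColumn {suc ℓ} (x ∷ xs) (s≤s l) = cong suc (length-addColumn xs l)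

sum-addColumn : ∀ {ℓ} xs → length xs ≤ ℓ → sum (addColumn ℓ xs) ≡ sum xs + ℓ
sum-addColumn {zero}  []       _       = refl
sum-addColumn {suc ℓ} []       _       = cong suc (sum-addColumn [] z≤n)
sum-addColumn {suc ℓ} (x ∷ xs) (s≤s l) = begin
  suc (x + sum (addColumn ℓ xs))  ≡⟨ cong (λ s → suc (x + s)) (sum-addColumn xs l) ⟩
  suc (x + (sum xs + ℓ))          ≡⟨ regroup x (sum xs) ℓ ⟩
  x + sum xs + suc ℓ              ∎
  where
  open ≡-Reasoning
  regroup : ∀ x s l → suc (x + (s + l)) ≡ x + s + suc l
  regroup = solve-∀

positive-addColumn : ∀ ℓ xs → All (0 <_) (addColumn ℓ xs)
positive-addColumn ℓ []       = replicate⁺ ℓ z<s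
positive-addColumn ℓ (x ∷ xs) = z<s ∷ positive-addColumn (pred ℓ) xs

≤-addColumn : ∀ {y} ℓ xs → All (_≤ y) xs → All (_≤ suc y) (addColumn ℓ xs)
≤-addColumn ℓ []       []           = replicate⁺ ℓ (s≤s z≤n)
≤-addColumn ℓ (x ∷ xs) (x≤y ∷ xs≤y) = s≤s x≤y ∷ ≤-addColumn (pred ℓ) xs xs≤y

sorted-addColumn : ∀ ℓ xs → T (nonincreasing xs) → T (nonincreasing (addColumn ℓ xs))
sorted-addColumn zero    []       _      = tt
sorted-addColumn (suc ℓ) []       _      = nonincreasing-∷⁺ _ (replicate⁺ ℓ ≤-refl) (sorted-addColumn ℓ [] tt)
sorted-addColumn ℓ       (x ∷ xs) sorted with nonincreasing-∷⁻ x xs sorted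
... | xs≤x , xs-sorted =
  nonincreasing-∷⁺ _ (≤-addColumn (pred ℓ) xs xs≤x) (sorted-addColumn (pred ℓ) xs xs-sorted)

dropColumn-addColumn : ∀ ℓ {xs} → All (0 <_) xs → dropColumn (addColumn ℓ xs) ≡ xs
dropColumn-addColumn ℓ {[]}         []        = dropColumn-≤1 (replicate⁺ ℓ ≤-refl)
dropColumn-addColumn ℓ {suc x ∷ xs} (_ ∷ pos) = cong (suc x ∷_) (dropColumn-addColumn (pred ℓ) pos)

addColumn-dropColumn : ∀ {xs} → All (0 <_) xs → T (nonincreasing xs) → addColumn (length xs) (dropColumn xs) ≡ xs
addColumn-dropColumn {[]}               []        _      = refl
addColumn-dropColumn {suc zero ∷ xs}    (_ ∷ pos) sorted with nonincreasing-∷⁻ 1 xs sorted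
... | xs≤1 , _ rewrite dropColumn-≤1 xs≤1 = cong (1 ∷_) (sym (positive-≤1⇒replicate pos xs≤1))
addColumn-dropColumn {suc (suc x) ∷ xs} (_ ∷ pos) sorted =
  cong (suc (suc x) ∷_) (addColumn-dropColumn pos (proj₂ (nonincreasing-∷⁻ _ xs sorted)))


-- Dyson's map and the rank recurrence

dyson : ℕ → List ℕ → List ℕ
dyson M π = prependPart (length π ∸ M) (dropColumn π)

dyson⁻¹ : ℕ → List ℕ → List ℕ
dyson⁻¹ M []       = addColumn M []
dyson⁻¹ M (x ∷ xs) = addColumn (x + M) xs

dyson-bounds : ∀ {m N π} → IsPartition (suc m + N) π → T (rank≤- m π) →
               (length π ∸ suc m) + suc m ≡ length π × All (_≤ length π ∸ suc m) (dropColumn π)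
dyson-bounds {m} {π = x ∷ xs} (mkIsPartition (0<x ∷ _) sorted _) rank≤ =
  k+M≡ℓ , All.map (λ d≤ → ≤-trans d≤ pred-x≤k) (≤-dropColumn (x ∷ xs) (≤-refl ∷ xs≤x))
  where
  ℓ = length (x ∷ xs)
  k = ℓ ∸ suc m
  xs≤x = proj₁ (nonincreasing-∷⁻ x xs sorted)
  x+m≤ℓ : x + m ≤ ℓ
  x+m≤ℓ = subst (λ y → y + m ≤ ℓ) (largestPart-∷ x xs xs≤x) (≤ᵇ⇒≤ _ _ rank≤)
  k+M≡ℓ : k + suc m ≡ ℓ
  k+M≡ℓ = m∸n+n≡m (≤-trans (+-monoˡ-≤ m 0<x) x+m≤ℓ)
  pred-x≤k : pred x ≤ k
  pred-x≤k = pred-mono-≤ (+-cancelʳ-≤ m x (suc k) (subst (x + m ≤_) (trans (sym k+M≡ℓ) (+-suc k m)) x+m≤ℓ))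

dyson-maps : ∀ {m N π} → IsPartition (suc m + N) π → T (rank≤- m π) →
             IsPartition N (dyson (suc m) π) × T (not (rank≤- (m + 3) (dyson (suc m) π)))
dyson-maps {m} {N} {π} isp@(mkIsPartition pos sorted sum≡) rank≤ =
  mkIsPartition (positive-prependPart k (positive-dropColumn π)) (sorted-prependPart k D≤k (sorted-dropColumn π sorted))
                (+-cancelʳ-≡ (suc m) _ _ sum+M≡N+M) ,
  not-T⁺ (λ h → 1+n≰n (too-long (≤ᵇ⇒≤ _ _ h)))
  where
  ℓ = length π
  k = ℓ ∸ suc m
  D = dropColumn π
  k+M≡ℓ = proj₁ (dyson-bounds isp rank≤)
  D≤k = proj₂ (dyson-bounds isp rank≤)
  sum+M≡N+M : sum (prependPart k D) + suc m ≡ N + suc m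
  sum+M≡N+M = begin
    sum (prependPart k D) + suc m  ≡⟨ cong (_+ suc m) (sum-prependPart k D) ⟩
    k + sum D + suc m              ≡⟨ regroup k (sum D) (suc m) ⟩
    sum D + (k + suc m)            ≡⟨ cong (sum D +_) k+M≡ℓ ⟩
    sum D + ℓ                      ≡⟨ sum-dropColumn pos ⟩
    sum π                          ≡⟨ trans sum≡ (+-comm (suc m) N) ⟩
    N + suc m                      ∎
    where
    open ≡-Reasoning
    regroup : ∀ k d M → k + d + M ≡ d + (k + M)
    regroup = solve-∀
  too-long : largestPart (prependPart k D) + (m + 3) ≤ length (prependPart k D) → suc (suc ℓ) ≤ suc ℓ
  too-long h = begin
    suc (suc ℓ)                              ≡⟨ cong (2 +_) (sym k+M≡ℓ) ⟩
    suc (suc (k + suc m))                    ≡⟨ regroup k m ⟩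
    k + (m + 3)                              ≤⟨ +-monoˡ-≤ (m + 3) (≤-largestPart-prependPart k D) ⟩
    largestPart (prependPart k D) + (m + 3)  ≤⟨ h ⟩
    length (prependPart k D)                 ≤⟨ length-prependPart k D ⟩
    suc (length D)                           ≤⟨ s≤s (length-dropColumn π) ⟩
    suc ℓ                                    ∎
    where
    open ≤-Reasoning
    regroup : ∀ k m → suc (suc (k + suc m)) ≡ k + (m + 3)
    regroup = solve-∀

dyson⁻¹-bound : ∀ {m} x xs → T (nonincreasing (x ∷ xs)) → T (not (rank≤- (m + 3) (x ∷ xs))) →
                length xs ≤ x + suc m
dyson⁻¹-bound {m} x xs sorted not-rank≤ = s≤s⁻¹ (s≤s⁻¹ (begin-strict
  suc (length xs)        <⟨ ≰⇒> not-long ⟩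
  x + (m + 3)            ≡⟨ regroup x m ⟩
  suc (suc (x + suc m))  ∎))
  where
  open ≤-Reasoning
  xs≤x = proj₁ (nonincreasing-∷⁻ x xs sorted)
  not-long : ¬ (x + (m + 3) ≤ suc (length xs))
  not-long = not-T⁻ not-rank≤ ∘ ≤⇒≤ᵇ ∘ subst (λ y → y + (m + 3) ≤ _) (sym (largestPart-∷ x xs xs≤x))
  regroup : ∀ x m → x + (m + 3) ≡ suc (suc (x + suc m))
  regroup = solve-∀

addColumn-maps : ∀ {m} h t → All (0 <_) t → T (nonincreasing t) → All (_≤ h) t → length t ≤ h + suc m →
                 IsPartition (suc m + (h + sum t)) (addColumn (h + suc m) t) × T (rank≤- m (addColumn (h + suc m) t))
addColumn-maps {m} h t pos sorted t≤h len =
  mkIsPartition (positive-addColumn ℓ t) (sorted-addColumn ℓ t sorted) (trans (sum-addColumn t len) (regroup (sum t) h m)) ,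
  ≤⇒≤ᵇ (begin
    largestPart (addColumn ℓ t) + m  ≤⟨ +-monoˡ-≤ m (largestPart-≤ _ (≤-addColumn ℓ t t≤h)) ⟩
    suc h + m                        ≡⟨ sym (+-suc h m) ⟩
    ℓ                                ≡⟨ sym (length-addColumn t len) ⟩
    length (addColumn ℓ t)           ∎)
  where
  open ≤-Reasoning
  ℓ = h + suc m
  regroup : ∀ s h m → s + (h + suc m) ≡ suc m + (h + s)
  regroup = solve-∀

dyson⁻¹-maps : ∀ {m N μ} → IsPartition N μ → T (not (rank≤- (m + 3) μ)) →
               IsPartition (suc m + N) (dyson⁻¹ (suc m) μ) × T (rank≤- m (dyson⁻¹ (suc m) μ))
dyson⁻¹-maps {μ = []}     (mkIsPartition _ _ refl) _ = addColumn-maps 0 [] [] tt [] z≤n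
dyson⁻¹-maps {μ = x ∷ xs} (mkIsPartition (_ ∷ pos) sorted refl) not-rank≤ =
  addColumn-maps x xs pos (proj₂ (nonincreasing-∷⁻ x xs sorted)) (proj₁ (nonincreasing-∷⁻ x xs sorted))
                 (dyson⁻¹-bound x xs sorted not-rank≤)

dyson⁻¹-prependPart : ∀ M k {ys} → All (0 <_) ys → All (_≤ k) ys →
                      dyson⁻¹ M (prependPart k ys) ≡ addColumn (k + M) ys
dyson⁻¹-prependPart M zero    pos ys≤0 rewrite positive-≤0⇒[] pos ys≤0 = refl
dyson⁻¹-prependPart M (suc k) _   _    = refl

dyson-addColumn : ∀ M h {t} → All (0 <_) t → length t ≤ h + M → dyson M (addColumn (h + M) t) ≡ prependPart h t
dyson-addColumn M h {t} pos len
  rewrite length-addColumn t len | m+n∸n≡m h M | dropColumn-addColumn (h + M) pos = refl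

dyson⁻¹∘dyson : ∀ {m N π} → IsPartition (suc m + N) π → T (rank≤- m π) →
                dyson⁻¹ (suc m) (dyson (suc m) π) ≡ π
dyson⁻¹∘dyson {m} {π = π} isp@(mkIsPartition pos sorted _) rank≤ = begin
  dyson⁻¹ (suc m) (dyson (suc m) π)     ≡⟨ dyson⁻¹-prependPart (suc m) k (positive-dropColumn π) D≤k ⟩
  addColumn (k + suc m) (dropColumn π)  ≡⟨ cong (λ ℓ → addColumn ℓ (dropColumn π)) k+M≡ℓ ⟩
  addColumn (length π) (dropColumn π)   ≡⟨ addColumn-dropColumn pos sorted ⟩
  π                                     ∎
  where
  open ≡-Reasoning
  k = length π ∸ suc m
  k+M≡ℓ = proj₁ (dyson-bounds isp rank≤)
  D≤k = proj₂ (dyson-bounds isp rank≤)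

dyson∘dyson⁻¹ : ∀ {m N μ} → IsPartition N μ → T (not (rank≤- (m + 3) μ)) →
                dyson (suc m) (dyson⁻¹ (suc m) μ) ≡ μ
dyson∘dyson⁻¹ {m} {μ = []}         _                                  _         = dyson-addColumn (suc m) 0 [] z≤n
dyson∘dyson⁻¹ {m} {μ = suc x ∷ xs} (mkIsPartition (_ ∷ pos) sorted _) not-rank≤ =
  dyson-addColumn (suc m) (suc x) pos (dyson⁻¹-bound (suc x) xs sorted not-rank≤)

dyson-↔ : ∀ m N → PartitionsWith N (not ∘ rank≤- (m + 3)) ↔ PartitionsWith (suc m + N) (rank≤- m)
dyson-↔ m N =
  PartitionsWith-↔ (dyson⁻¹ (suc m)) (dyson (suc m)) dyson⁻¹-maps dyson-maps dyson∘dyson⁻¹ dyson⁻¹∘dyson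

#rank≤-recurrence : ∀ m N → #partitions (suc m + N) (rank≤- m) + #partitions N (rank≤- (m + 3)) ≡ partitionCount N
#rank≤-recurrence m N = #partitions-recurrence (dyson-↔ m N)

#mexCond≡#rank≤ : ∀ n k → #partitions n (mexCond 3 (2 + k)) ≡ #partitions n (rank≤- (suc k))
#mexCond≡#rank≤ = <-rec _ step
  where
  step : ∀ n → (∀ {N} → N < n → ∀ k → #partitions N (mexCond 3 (2 + k)) ≡ #partitions N (rank≤- (suc k))) →
         ∀ k → #partitions n (mexCond 3 (2 + k)) ≡ #partitions n (rank≤- (suc k))
  step n rec k with n <? 2 + k
  ... | yes n<2+k = trans (#mexCond-small 3 n<2+k) (sym (#rank≤-small n<2+k))
  ... | no  n≮2+k with m≤n⇒∃[o]m+o≡n (≮⇒≥ n≮2+k)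
  ...   | N , refl = +-cancelʳ-≡ (#partitions N (mexCond 3 (2 + k + 3))) _ _ (begin
    #partitions (2 + k + N) (mexCond 3 (2 + k)) + #partitions N (mexCond 3 (2 + k + 3))
      ≡⟨ #mexCond-recurrence 3 (2 + k) N z<s ⟩
    partitionCount N
      ≡⟨ sym (#rank≤-recurrence (suc k) N) ⟩
    #partitions (2 + k + N) (rank≤- (suc k)) + #partitions N (rank≤- (suc k + 3))
      ≡⟨ cong (#partitions (2 + k + N) (rank≤- (suc k)) +_) (sym (rec (m<n+m N z<s) (k + 3))) ⟩
    #partitions (2 + k + N) (rank≤- (suc k)) + #partitions N (mexCond 3 (2 + k + 3))  ∎)
    where open ≡-Reasoning

corollary3p4 : (n : ℕ) → PartitionsWith (suc n) (mexCond 3 3) ↔ PartitionsWith (suc n) gardenOfEden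
corollary3p4 n = begin
  PartitionsWith (suc n) (mexCond 3 3)     ↔⟨ PartitionsWith↔Fin (suc n) (mexCond 3 3) ⟩
  Fin (#partitions (suc n) (mexCond 3 3))  ≡⟨ cong Fin (#mexCond≡#rank≤ (suc n) 1) ⟩
  Fin (#partitions (suc n) (rank≤- 2))     ↔⟨ PartitionsWith↔Fin (suc n) (rank≤- 2) ⟨
  PartitionsWith (suc n) (rank≤- 2)        ↔⟨ PartitionsWith-cong (sym ∘ rank≤?-[1+k] 1) ⟩
  PartitionsWith (suc n) gardenOfEden      ∎
  where open EquationalReasoning
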